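{- Let $h$ and $t$ be integers with $2 \leq t \leq \log h / \log 2$. Then there exists a partition $\mathbb{N} = W_0 \cup W_1 \cup \dots \cup W_{h-1}$ of $\mathbb{N}$ into pairwise disjoint sets such that each set $W_i$ ($0 \le i \le h-1$) is a union of infinitely many intervals, each consisting of at least $t$ consecutive integers, and such that $$A = A(W_0) \cup A(W_1) \cup \dots \cup A(W_{h-1})$$ is not a minimal asymptotic basis of order $h$.
   Context: $\mathbb{N}$ denotes the set of all nonnegative integers. For a nonempty subset $W \subseteq \mathbb{N}$, $A(W)$ denotes the set of all integers of the form $\sum_{f \in F} 2^f$, where $F$ ranges over all finite nonempty subsets of $W$. For $h \ge 2$, a set $A \subseteq \mathbb{N}$ is an asymptotic basis of order $h$ if every sufficiently large integer $n$ can be written as $n = a_1 + \dots + a_h$ with $a_1, \dots, a_h \in A$ (not necessarily distinct). An asymptotic basis $A$ of order $h$ is minimal if no proper subset of $A$ is an asymptotic basis of order $h$. -}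

module Defs where

open import Data.Nat using (ℕ; suc; _+_; _^_; _≤_; _<_)
open import Data.Fin using (Fin)
open import Data.List using (List; []; _∷_; map)
open import Data.Nat.ListAction using (sum)
open import Data.List.Relation.Unary.All using (All)
open import Data.List.Relation.Unary.Unique.Propositional using (Unique)
open import Data.Vec as Vec using (Vec)
import Data.Vec.Relation.Unary.All as VAll
open import Data.Product using (Σ; ∃; ∃-syntax; _×_)
open import Relation.Nullary using (¬_)
open import Relation.Binary.PropositionalEquality using (_≡_; _≢_)
open import Relation.Unary using (Pred; _⊆_)
open import Level using (0ℓ)

-- A(W): all integers Σ_{f ∈ F} 2^f, F a finite nonempty subset of W.
-- A finite subset F is represented by a duplicate-free list of its elements.
A[_] : Pred ℕ 0ℓ → Pred ℕ 0ℓ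
A[ W ] n = Σ (List ℕ) λ F → (F ≢ []) × Unique F × All W F × (n ≡ sum (map (2 ^_) F))

IsAsymptoticBasis : ℕ → Pred ℕ 0ℓ → Set
IsAsymptoticBasis h A =
  ∃[ N ] ∀ n → N ≤ n → Σ (Vec ℕ h) λ a → VAll.All A a × (n ≡ Vec.sum a)

IsMinimalAsymptoticBasis : ℕ → Pred ℕ 0ℓ → Set₁
IsMinimalAsymptoticBasis h A =
  IsAsymptoticBasis h A ×
  (∀ (B : Pred ℕ 0ℓ) → B ⊆ A → (∃[ x ] (A x × ¬ B x)) → ¬ IsAsymptoticBasis h B)

-- W is a union of infinitely many intervals, each consisting of at least t
-- consecutive integers: every element of W lies in a block of t consecutive
-- integers contained in W, and W has infinitely many maximal blocks
-- (infinitely many m ∈ W with m+1 ∉ W), so every maximal block is finite.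
UnionOfIntervals : ℕ → Pred ℕ 0ℓ → Set
UnionOfIntervals t W =
  (∀ n → W n → ∃[ a ] (a ≤ n × n < a + t × (∀ k → a ≤ k → k < a + t → W k)))
  × (∀ N → ∃[ m ] (N ≤ m × W m × ¬ W (suc m)))

-- The i-th class of the partition of ℕ given by a colouring c : ℕ → Fin h.
Part : {h : ℕ} → (ℕ → Fin h) → Fin h → Pred ℕ 0ℓ
Part c i n = c n ≡ i

UnionA : {h : ℕ} → (ℕ → Fin h) → Pred ℕ 0ℓ
UnionA {h} c n = ∃[ i ] A[ Part c i ] n

-- Colour ℕ with period S = h + t: in the q-th period the first h integers get colour 0 and
-- the last t get colour 1 + (q mod (h − 1)). Then 1 = 2⁰ ∈ A, and A ∖ {1} is still a basis of
-- order h. For n ≥ 2^S, expand n in base 2^S and split each digit x = low + high · 2^h into its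
-- bits in the colour-0 part and in the coloured part of its period; this writes n as a sum of
-- h elements of A ∪ {0}, one for each colour. A zero summand is removed by taking a bit 2^f with
-- f ≥ h out of some summand and spreading it over the z zero summands as
-- 2^(f−1) + ⋯ + 2^(f−z+1) + 2^(f−z+1); the bit is chosen so that what it leaves behind is not 1.
-- If the colour-0 summand is exactly 1, every digit is instead written as a sum of h numbers below
-- 2^h, all placed in the colour-0 part of its period, which is possible because high < 2^t ≤ h;
-- then every summand is at least 2^S.

module Submission where

open import Defs
open import Data.Nat using (ℕ; zero; suc; _+_; _*_; _∸_; _^_; _≤_; _<_; z≤n; s≤s; s≤s⁻¹; z<s; s<s; pred; NonZero; _≟_; _≤?_; _<?_; _%_; _/_)
open import Data.Nat.Properties
open import Data.Nat.DivMod
open import Data.Nat.Divisibility using (divides)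
open import Data.List as List using (List; []; _∷_; map; _++_)
open import Data.List.Properties using (map-++)
open import Data.Nat.ListAction using (sum)
open import Data.Nat.ListAction.Properties using (sum-++; sum-↭)
open import Data.List.Membership.Propositional using (_∈_; find; lose)
open import Data.List.Membership.Propositional.Properties using (∈-∃++)
open import Data.List.Membership.DecPropositional _≟_ using (_∈?_)
open import Data.List.Relation.Unary.All as All using (All; []; _∷_)
import Data.List.Relation.Unary.All.Properties as All
open import Data.List.Relation.Unary.Any as Any using (Any)
open import Data.List.Relation.Unary.AllPairs using ([]; _∷_)
open import Data.List.Relation.Unary.Unique.Propositional using (Unique)
import Data.List.Relation.Unary.Unique.Propositional.Properties as Unique
open import Data.List.Relation.Binary.Permutation.Propositional using (_↭_; ↭⇒↭ₛ)
import Data.List.Relation.Binary.Permutation.Propositional.Properties as ↭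
import Data.List.Relation.Binary.Permutation.Setoid.Properties as ↭ₛ
open import Data.Vec as Vec using (Vec; []; _∷_; count; _[_]≔_)
open import Data.Vec.Properties using (count≤n; lookup-zipWith; lookup-map; lookup-replicate; lookup∘update; lookup∘update′)
open import Data.Vec.Relation.Unary.All as VAll using ([]; _∷_)
import Data.Vec.Relation.Unary.All.Properties as VAllₚ
open import Algebra.Properties.CommutativeSemigroup +-commutativeSemigroup using (interchange)
open import Data.Fin as Fin using (Fin; zero; suc)
import Data.Fin.Properties as Finₚ
open import Data.Sum using (inj₁; inj₂)
open import Data.Product using (Σ; ∃; ∃-syntax; _×_; _,_; proj₁; proj₂)
open import Data.Empty using (⊥-elim)
open import Relation.Nullary using (¬_; yes; no; ¬?)
open import Relation.Nullary.Decidable using (decidable-stable)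
open import Relation.Binary.PropositionalEquality
open import Relation.Unary using (Pred)
open import Level using (0ℓ)
open import Function using (_∘_)
open import Data.Nat.Tactic.RingSolver using (solve-∀)

2^n+2^n≡2^[1+n] : ∀ n → 2 ^ n + 2 ^ n ≡ 2 ^ suc n
2^n+2^n≡2^[1+n] n = cong (2 ^ n +_) (sym (+-identityʳ (2 ^ n)))

n<2^n : ∀ n → n < 2 ^ n
n<2^n zero = z<s
n<2^n (suc n) = <-≤-trans (s<s (n<2^n n))
  (subst (1 + 2 ^ n ≤_) (2^n+2^n≡2^[1+n] n) (+-monoˡ-≤ (2 ^ n) (m^n>0 2 n)))

window : ∀ {t lo len n} → 1 ≤ t → t ≤ len → lo ≤ n → n < lo + len →
         ∃[ a ] (lo ≤ a × a ≤ n × n < a + t × a + t ≤ lo + len)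
window {t} {lo} {len} {n} 1≤t t≤len lo≤n n<lo+len with n + t ≤? lo + len
... | yes fits = n , lo≤n , ≤-refl , m<m+n n 1≤t , fits
... | no ¬fits = lo + (len ∸ t) , m≤m+n lo (len ∸ t) , a≤n , subst (n <_) (sym a+t≡) n<lo+len , ≤-reflexive a+t≡
  where
  a+t≡ : lo + (len ∸ t) + t ≡ lo + len
  a+t≡ = trans (+-assoc lo (len ∸ t) t) (cong (lo +_) (m∸n+n≡m t≤len))
  a≤n : lo + (len ∸ t) ≤ n
  a≤n = +-cancelʳ-≤ t _ _ (≤-trans (≤-reflexive a+t≡) (<⇒≤ (≰⇒> ¬fits)))

toℕ+kn-mod : ∀ {n} .{{_ : NonZero n}} (i : Fin n) k → (Fin.toℕ i + k * n) mod n ≡ i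
toℕ+kn-mod {n} i k = Finₚ.toℕ-injective (begin
  Fin.toℕ ((Fin.toℕ i + k * n) mod n)   ≡⟨ Finₚ.toℕ-fromℕ< (m%n<n (Fin.toℕ i + k * n) n) ⟩
  (Fin.toℕ i + k * n) % n               ≡⟨ [m+kn]%n≡m%n (Fin.toℕ i) k n ⟩
  Fin.toℕ i % n                         ≡⟨ m<n⇒m%n≡m (Finₚ.toℕ<n i) ⟩
  Fin.toℕ i                             ∎)
  where open ≡-Reasoning

2^e+1+[2^t-1]2^[1+e]+2^e≡2^[t+1+e]+1 : ∀ t e → 1 ≤ 2 ^ t →
  2 ^ e + 1 + (2 ^ t ∸ 1) * 2 ^ suc e + 2 ^ e ≡ 2 ^ (t + suc e) + 1
2^e+1+[2^t-1]2^[1+e]+2^e≡2^[t+1+e]+1 t e 1≤2^t = begin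
  2 ^ e + 1 + (2 ^ t ∸ 1) * 2 ^ suc e + 2 ^ e   ≡⟨ rearrange (2 ^ e) (2 ^ t ∸ 1) ⟩
  (2 ^ t ∸ 1 + 1) * 2 ^ suc e + 1               ≡⟨ cong (λ m → m * 2 ^ suc e + 1) (m∸n+n≡m 1≤2^t) ⟩
  2 ^ t * 2 ^ suc e + 1                         ≡⟨ cong (_+ 1) (^-distribˡ-+-* 2 t (suc e)) ⟨
  2 ^ (t + suc e) + 1                           ∎
  where
  open ≡-Reasoning
  rearrange : ∀ p m → p + 1 + m * (p + (p + 0)) + p ≡ (m + 1) * (p + (p + 0)) + 1
  rearrange = solve-∀

[m*n+r]%n≡r : ∀ m {n r} .{{_ : NonZero n}} → r < n → (m * n + r) % n ≡ r
[m*n+r]%n≡r m {n} {r} r<n = trans (cong (_% n) (+-comm (m * n) r))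
  (trans ([m+kn]%n≡m%n r m n) (m<n⇒m%n≡m r<n))

[m*n+r]/n≡m : ∀ m {n r} .{{_ : NonZero n}} → r < n → (m * n + r) / n ≡ m
[m*n+r]/n≡m m {n} {r} r<n = trans (cong (_/ n) (+-comm (m * n) r))
  (trans (+-distrib-/-∣ʳ r (divides m refl)) (cong₂ _+_ (m<n⇒m/n≡0 r<n) (m*n/n≡m m n)))

-- Sums of distinct powers of two

∑2^ : List ℕ → ℕ
∑2^ F = sum (map (2 ^_) F)

∑2^-++ : ∀ F G → ∑2^ (F ++ G) ≡ ∑2^ F + ∑2^ G
∑2^-++ F G = trans (cong sum (map-++ (2 ^_) F G)) (sum-++ (map (2 ^_) F) (map (2 ^_) G))

∑2^-↭ : ∀ {F G} → F ↭ G → ∑2^ F ≡ ∑2^ G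
∑2^-↭ F↭G = sum-↭ (↭.map⁺ (2 ^_) F↭G)

∑2^-remove : ∀ {W : Pred ℕ 0ℓ} {F f} → Unique F → All W F → f ∈ F →
  ∃[ R ] (Unique R × All W R × All (f ≢_) R × ∑2^ F ≡ 2 ^ f + ∑2^ R)
∑2^-remove {f = f} uF wF f∈F
  with ys , zs , refl ← ∈-∃++ f∈F
  with F↭f∷R ← ↭.shift f ys zs
  with f∉R ∷ uR ← ↭ₛ.Unique-resp-↭ (setoid ℕ) (↭⇒↭ₛ F↭f∷R) uF
  with _ ∷ wR ← ↭.All-resp-↭ F↭f∷R wF
  = ys ++ zs , uR , wR , f∉R , ∑2^-↭ F↭f∷R

All-<-≢⇒< : ∀ {K G} → All (_< suc K) G → All (K ≢_) G → All (_< K) G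
All-<-≢⇒< G<1+K G≢K = All.zipWith (λ (f<1+K , K≢f) → ≤∧≢⇒< (s≤s⁻¹ f<1+K) (K≢f ∘ sym)) (G<1+K , G≢K)

∑2^<2^ : ∀ K F → Unique F → All (_< K) F → ∑2^ F < 2 ^ K
∑2^<2^ zero [] _ _ = s≤s z≤n
∑2^<2^ zero (_ ∷ _) _ (() ∷ _)
∑2^<2^ (suc K) F uF F≤K with K ∈? F
... | yes K∈F with R , uR , R≤K , K∉R , eq ← ∑2^-remove uF F≤K K∈F = begin-strict
  ∑2^ F           ≡⟨ eq ⟩
  2 ^ K + ∑2^ R   <⟨ +-monoʳ-< (2 ^ K) (∑2^<2^ K R uR (All-<-≢⇒< R≤K K∉R)) ⟩
  2 ^ K + 2 ^ K   ≡⟨ 2^n+2^n≡2^[1+n] K ⟩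
  2 ^ suc K       ∎
  where open ≤-Reasoning
... | no K∉F = begin-strict
  ∑2^ F           <⟨ ∑2^<2^ K F uF (All-<-≢⇒< F≤K (All.¬Any⇒All¬ F K∉F)) ⟩
  2 ^ K           ≤⟨ m≤m+n (2 ^ K) (2 ^ K) ⟩
  2 ^ K + 2 ^ K   ≡⟨ 2^n+2^n≡2^[1+n] K ⟩
  2 ^ suc K       ∎
  where open ≤-Reasoning

2^K≤∑2^⇒∃exponent≥K : ∀ K F → Unique F → 2 ^ K ≤ ∑2^ F → Any (K ≤_) F
2^K≤∑2^⇒∃exponent≥K K F uF 2^K≤ with Any.any? (K ≤?_) F
... | yes K≤f = K≤f
... | no ¬K≤f = ⊥-elim (<⇒≱ (∑2^<2^ K F uF (All.map ≰⇒> (All.¬Any⇒All¬ F ¬K≤f))) 2^K≤)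

∑2^-even : ∀ {F} → All (1 ≤_) F → ∃[ k ] ∑2^ F ≡ 2 * k
∑2^-even [] = 0 , refl
∑2^-even {suc f ∷ F} (_ ∷ F≥1) with k , eq ← ∑2^-even F≥1 =
  2 ^ f + k , trans (cong (2 ^ suc f +_) eq) (sym (*-distribˡ-+ 2 (2 ^ f) k))

∑2^≢1 : ∀ {F} → All (1 ≤_) F → ∑2^ F ≢ 1
∑2^≢1 F≥1 with k , ∑≡2k ← ∑2^-even F≥1 = λ ∑≡1 → even≢odd k 0 (trans (sym ∑≡2k) ∑≡1)

A-∑2^ : ∀ {W F} → Unique F → All W F → ∑2^ F ≢ 0 → A[ W ] (∑2^ F)
A-∑2^ {F = []} _ _ ∑≢0 = ⊥-elim (∑≢0 refl)
A-∑2^ {F = f ∷ F} uF wF _ = f ∷ F , (λ ()) , uF , wF , refl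

A⇒≢0 : ∀ {W n} → A[ W ] n → n ≢ 0
A⇒≢0 ([] , F≢[] , _) _ = F≢[] refl
A⇒≢0 (f ∷ F , _ , _ , _ , refl) = <⇒≢ (≤-trans (m^n>0 2 f) (m≤m+n (2 ^ f) (∑2^ F))) ∘ sym

BitSum : Pred ℕ 0ℓ → ℕ → ℕ → Pred ℕ 0ℓ
BitSum W lo hi v = ∃[ F ] (Unique F × All W F × All (λ f → lo ≤ f × f < hi) F × v ≡ ∑2^ F)

module _ {W : Pred ℕ 0ℓ} where

  bitSum-0 : ∀ {lo hi} → BitSum W lo hi 0
  bitSum-0 = [] , [] , [] , [] , refl

  bitSum-2^ : ∀ {lo hi f} → W f → lo ≤ f → f < hi → BitSum W lo hi (2 ^ f)
  bitSum-2^ {f = f} wf lo≤f f<hi = f ∷ [] , [] ∷ [] , wf ∷ [] , (lo≤f , f<hi) ∷ [] , sym (+-identityʳ _)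

  bitSum-+ : ∀ {lo mid hi u v} → lo ≤ mid → mid ≤ hi →
             BitSum W lo mid u → BitSum W mid hi v → BitSum W lo hi (u + v)
  bitSum-+ lo≤mid mid≤hi (F , uF , wF , rF , refl) (G , uG , wG , rG , refl) =
    F ++ G , Unique.++⁺ uF uG separated , All.++⁺ wF wG ,
    All.++⁺ (All.map (λ (lo≤f , f<mid) → lo≤f , <-≤-trans f<mid mid≤hi) rF)
            (All.map (λ (mid≤g , g<hi) → ≤-trans lo≤mid mid≤g , g<hi) rG) ,
    sym (∑2^-++ F G)
    where
    separated : ∀ {v} → ¬ (v ∈ F × v ∈ G)
    separated (v∈F , v∈G) = <⇒≱ (proj₂ (All.lookup rF v∈F)) (proj₁ (All.lookup rG v∈G))

  bitSum-widen : ∀ {lo hi lo′ hi′ v} → lo′ ≤ lo → hi ≤ hi′ → BitSum W lo hi v → BitSum W lo′ hi′ v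
  bitSum-widen lo′≤lo hi≤hi′ (F , uF , wF , rF , eq) =
    F , uF , wF , All.map (λ (lo≤f , f<hi) → ≤-trans lo′≤lo lo≤f , <-≤-trans f<hi hi≤hi′) rF , eq

  bitSum⇒A : ∀ {lo hi v} → BitSum W lo hi v → v ≢ 0 → A[ W ] v
  bitSum⇒A (F , uF , wF , _ , refl) = A-∑2^ uF wF

  bitSum-binary : ∀ K o w → w < 2 ^ K → (∀ f → o ≤ f → f < o + K → W f) →
                  BitSum W o (o + K) (w * 2 ^ o)
  bitSum-binary zero o zero _ _ = bitSum-0
  bitSum-binary zero o (suc w) (s≤s ()) _
  bitSum-binary (suc K) o w w<2^[1+K] W⊇ =
    subst (BitSum W o (o + suc K)) (sym split)
      (bitSum-+ (n≤1+n o) (m<m+n o z<s) lowBit highBits′)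
    where
    split : w * 2 ^ o ≡ w % 2 * 2 ^ o + w / 2 * 2 ^ suc o
    split = begin
      w * 2 ^ o                            ≡⟨ cong (_* 2 ^ o) (m≡m%n+[m/n]*n w 2) ⟩
      (w % 2 + w / 2 * 2) * 2 ^ o          ≡⟨ *-distribʳ-+ (2 ^ o) (w % 2) (w / 2 * 2) ⟩
      w % 2 * 2 ^ o + w / 2 * 2 * 2 ^ o    ≡⟨ cong (w % 2 * 2 ^ o +_) (*-assoc (w / 2) 2 (2 ^ o)) ⟩
      w % 2 * 2 ^ o + w / 2 * 2 ^ suc o    ∎
      where open ≡-Reasoning
    lowBit : BitSum W o (suc o) (w % 2 * 2 ^ o)
    lowBit with w % 2 | m%n<n w 2
    ... | 0 | _ = bitSum-0
    ... | 1 | _ = subst (BitSum W o (suc o)) (sym (+-identityʳ _))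
                    (bitSum-2^ (W⊇ o ≤-refl (m<m+n o z<s)) ≤-refl ≤-refl)
    ... | suc (suc _) | s≤s (s≤s ())
    highBits : BitSum W (suc o) (suc o + K) (w / 2 * 2 ^ suc o)
    highBits = bitSum-binary K (suc o) (w / 2) (m<n*o⇒m/o<n (subst (w <_) (*-comm 2 (2 ^ K)) w<2^[1+K]))
      λ f 1+o≤f f<1+o+K → W⊇ f (≤-trans (n≤1+n o) 1+o≤f) (subst (f <_) (sym (+-suc o K)) f<1+o+K)
    highBits′ : BitSum W (suc o) (o + suc K) (w / 2 * 2 ^ suc o)
    highBits′ = subst (λ hi → BitSum W (suc o) hi (w / 2 * 2 ^ suc o)) (sym (+-suc o K)) highBits

zeros : ∀ {k} → Vec ℕ k → ℕ
zeros = count (_≟ 0)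

All-replicate : ∀ {P : Pred ℕ 0ℓ} k {y} → P y → VAll.All P (Vec.replicate k y)
All-replicate zero _ = []
All-replicate (suc k) py = py ∷ All-replicate k py

zeros-nonzero∷ : ∀ {k x} (xs : Vec ℕ k) → x ≢ 0 → zeros (x ∷ xs) ≡ zeros xs
zeros-nonzero∷ {x = zero} _ x≢0 = ⊥-elim (x≢0 refl)
zeros-nonzero∷ {x = suc _} _ _ = refl

zeros-replicate : ∀ k → zeros (Vec.replicate k 0) ≡ k
zeros-replicate zero = refl
zeros-replicate (suc k) = cong suc (zeros-replicate k)

spread : ∀ {k} → Vec ℕ k → ℕ → Vec ℕ k
spread [] f = []
spread (suc x ∷ xs) f = suc x ∷ spread xs f
spread (zero ∷ xs) f with zeros xs
... | zero = 2 ^ f ∷ xs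
... | suc _ = 2 ^ pred f ∷ spread xs (pred f)

module _ {P : Pred ℕ 0ℓ} where

  NonzeroIn : ∀ {k} → Vec ℕ k → Set
  NonzeroIn = VAll.All (λ y → y ≢ 0 → P y)

  nonzeroIn-replicate : ∀ k → NonzeroIn (Vec.replicate k 0)
  nonzeroIn-replicate k = All-replicate k (λ 0≢0 → ⊥-elim (0≢0 refl))

  nonzeroIn⇒All : ∀ {k} (v : Vec ℕ k) → NonzeroIn v → zeros v ≡ 0 → VAll.All P v
  nonzeroIn⇒All [] [] _ = []
  nonzeroIn⇒All (suc x ∷ xs) (px ∷ pxs) z≡0 = px (λ ()) ∷ nonzeroIn⇒All xs pxs z≡0

  spread-sound : (∀ f → 1 ≤ f → P (2 ^ f)) → ∀ {k} (v : Vec ℕ k) f → NonzeroIn v →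
                 1 ≤ zeros v → zeros v ≤ f →
                 VAll.All P (spread v f) × Vec.sum (spread v f) ≡ Vec.sum v + 2 ^ f
  spread-sound P-2^ (suc x ∷ xs) f (px ∷ pxs) 1≤z z≤f
    with ps , eq ← spread-sound P-2^ xs f pxs 1≤z z≤f =
    px (λ ()) ∷ ps , trans (cong (suc x +_) eq) (sym (+-assoc (suc x) (Vec.sum xs) (2 ^ f)))
  spread-sound P-2^ (zero ∷ xs) f (_ ∷ pxs) 1≤z z≤f with zeros xs in eq
  ... | zero = P-2^ f z≤f ∷ nonzeroIn⇒All xs pxs eq , +-comm (2 ^ f) (Vec.sum xs)
  spread-sound P-2^ (zero ∷ xs) (suc f) (_ ∷ pxs) 1≤z (s≤s z≤f) | suc m
    with ps , eq′ ← spread-sound P-2^ xs f pxs (subst (1 ≤_) (sym eq) z<s) (subst (_≤ f) (sym eq) z≤f) =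
    P-2^ f (≤-trans z<s z≤f) ∷ ps , (begin
      2 ^ f + Vec.sum (spread xs f)   ≡⟨ cong (2 ^ f +_) eq′ ⟩
      2 ^ f + (Vec.sum xs + 2 ^ f)    ≡⟨ +-comm (2 ^ f) _ ⟩
      Vec.sum xs + 2 ^ f + 2 ^ f      ≡⟨ +-assoc (Vec.sum xs) (2 ^ f) (2 ^ f) ⟩
      Vec.sum xs + (2 ^ f + 2 ^ f)    ≡⟨ cong (Vec.sum xs +_) (2^n+2^n≡2^[1+n] f) ⟩
      Vec.sum xs + 2 ^ suc f          ∎)
    where open ≡-Reasoning

sum-zipWith-+ : ∀ {k} (u v : Vec ℕ k) → Vec.sum (Vec.zipWith _+_ u v) ≡ Vec.sum u + Vec.sum v
sum-zipWith-+ [] [] = refl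
sum-zipWith-+ (x ∷ u) (y ∷ v) = trans (cong (x + y +_) (sum-zipWith-+ u v)) (interchange x y _ _)

sum-map-* : ∀ {k} m (v : Vec ℕ k) → Vec.sum (Vec.map (m *_) v) ≡ m * Vec.sum v
sum-map-* m [] = sym (*-zeroʳ m)
sum-map-* m (x ∷ v) = trans (cong (m * x +_) (sum-map-* m v)) (sym (*-distribˡ-+ m x (Vec.sum v)))

sum-replicate : ∀ k y → Vec.sum (Vec.replicate k y) ≡ k * y
sum-replicate zero y = refl
sum-replicate (suc k) y = cong (y +_) (sum-replicate k y)

sum-replicate0 : ∀ k → Vec.sum (Vec.replicate k 0) ≡ 0
sum-replicate0 k = trans (sum-replicate k 0) (*-zeroʳ k)

sum-replicate0[]≔ : ∀ {k} (i : Fin k) y → Vec.sum (Vec.replicate k 0 [ i ]≔ y) ≡ y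
sum-replicate0[]≔ {suc k} zero y = trans (cong (y +_) (sum-replicate0 k)) (+-identityʳ y)
sum-replicate0[]≔ (suc i) y = sum-replicate0[]≔ i y

sum-zeroTail : ∀ {k} (v : Vec ℕ (suc k)) → (∀ i → Vec.lookup v (suc i) ≡ 0) → Vec.sum v ≡ Vec.lookup v zero
sum-zeroTail (x ∷ []) _ = +-identityʳ x
sum-zeroTail (x ∷ y ∷ xs) tail≡0 =
  trans (cong (λ z → x + (z + Vec.sum xs)) (tail≡0 zero))
        (sum-zeroTail (x ∷ xs) (tail≡0 ∘ suc))

sum-[]≔ : ∀ {k} (v : Vec ℕ k) i y → Vec.sum (v [ i ]≔ y) + Vec.lookup v i ≡ Vec.sum v + y
sum-[]≔ (x ∷ xs) zero y = begin
  y + Vec.sum xs + x     ≡⟨ +-comm (y + Vec.sum xs) x ⟩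
  x + (y + Vec.sum xs)   ≡⟨ cong (x +_) (+-comm y (Vec.sum xs)) ⟩
  x + (Vec.sum xs + y)   ≡⟨ +-assoc x (Vec.sum xs) y ⟨
  x + Vec.sum xs + y     ∎
  where open ≡-Reasoning
sum-[]≔ (x ∷ xs) (suc i) y =
  trans (+-assoc x _ _) (trans (cong (x +_) (sum-[]≔ xs i y)) (sym (+-assoc x _ y)))

zeros-[]≔ : ∀ {k} (v : Vec ℕ k) i y → Vec.lookup v i ≢ 0 → zeros v ≤ zeros (v [ i ]≔ y)
zeros-[]≔ (zero ∷ xs) zero y v₀≢0 = ⊥-elim (v₀≢0 refl)
zeros-[]≔ (suc x ∷ xs) zero zero _ = n≤1+n (zeros xs)
zeros-[]≔ (suc x ∷ xs) zero (suc y) _ = ≤-refl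
zeros-[]≔ (zero ∷ xs) (suc i) y vᵢ≢0 = s≤s (zeros-[]≔ xs i y vᵢ≢0)
zeros-[]≔ (suc x ∷ xs) (suc i) y vᵢ≢0 = zeros-[]≔ xs i y vᵢ≢0

All-[]≔ : ∀ {P : Pred ℕ 0ℓ} {k} {v : Vec ℕ k} i {y} → VAll.All P v → P y → VAll.All P (v [ i ]≔ y)
All-[]≔ zero (_ ∷ ps) py = py ∷ ps
All-[]≔ (suc i) (p ∷ ps) py = p ∷ All-[]≔ i ps py

Representable : ℕ → Pred ℕ 0ℓ → Pred ℕ 0ℓ
Representable h A n = Σ (Vec ℕ h) λ a → VAll.All A a × n ≡ Vec.sum a

module Construction (H₁ t : ℕ) (1≤H₁ : 1 ≤ H₁) (1≤t : 1 ≤ t) (2^t≤h : 2 ^ t ≤ 2 + H₁) where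

  H h S : ℕ
  H = suc H₁
  h = suc H
  S = h + t

  -- The colouring and its intervals

  colour : ℕ → Fin h
  colour f with f % S <? h
  ... | yes _ = zero
  ... | no _ = suc ((f / S) mod H)

  colour≢zero⇒ : ∀ f → colour f ≢ zero → h ≤ f % S
  colour≢zero⇒ f neq with f % S <? h
  ... | yes _ = ⊥-elim (neq refl)
  ... | no r≮h = ≮⇒≥ r≮h

  colour≡suc⇒h≤ : ∀ f {i} → colour f ≡ suc i → h ≤ f
  colour≡suc⇒h≤ f eq = ≤-trans (colour≢zero⇒ f (λ eq′ → Finₚ.0≢1+n (trans (sym eq′) eq))) (m%n≤m f S)

  colour-low : ∀ q f → q * S ≤ f → f < q * S + h → colour f ≡ zero
  colour-low q f qS≤f f<qS+h with r , refl ← m≤n⇒∃[o]m+o≡n qS≤f with (q * S + r) % S <? h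
  ... | yes _ = refl
  ... | no r≮h = ⊥-elim (r≮h (subst (_< h) (sym ([m*n+r]%n≡r q (<-≤-trans r<h (m≤m+n h t)))) r<h))
    where
    r<h : r < h
    r<h = +-cancelˡ-< (q * S) r h f<qS+h

  colour-high : ∀ q f → q * S + h ≤ f → f < q * S + S → colour f ≡ suc (q mod H)
  colour-high q f qS+h≤f f<qS+S
    with r , refl ← m≤n⇒∃[o]m+o≡n (≤-trans (m≤m+n (q * S) h) qS+h≤f)
    with (q * S + r) % S <? h | [m*n+r]%n≡r q (+-cancelˡ-< (q * S) r S f<qS+S)
  ... | yes r%S<h | r%S≡r = ⊥-elim (<⇒≱ (subst (_< h) r%S≡r r%S<h) (+-cancelˡ-≤ (q * S) h r qS+h≤f))
  ... | no _ | _ = cong (λ x → suc (x mod H)) ([m*n+r]/n≡m q (+-cancelˡ-< (q * S) r S f<qS+S))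

  t<h : t < h
  t<h = <-≤-trans (n<2^n t) 2^t≤h

  n≡[n/S]S+n%S : ∀ n → n ≡ n / S * S + n % S
  n≡[n/S]S+n%S n = trans (m≡m%n+[m/n]*n n S) (+-comm (n % S) (n / S * S))

  monochromeBlock : ∀ n → ∃[ lo ] ∃[ len ]
    (t ≤ len × lo ≤ n × n < lo + len × (∀ k → lo ≤ k → k < lo + len → colour k ≡ colour n))
  monochromeBlock n with n % S <? h | n≡[n/S]S+n%S n
  ... | yes r<h | n≡ =
    n / S * S , h , <⇒≤ t<h ,
    subst (n / S * S ≤_) (sym n≡) (m≤m+n (n / S * S) (n % S)) ,
    subst (_< n / S * S + h) (sym n≡) (+-monoʳ-< (n / S * S) r<h) ,
    colour-low (n / S)
  ... | no r≮h | n≡ =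
    n / S * S + h , t , ≤-refl ,
    subst (n / S * S + h ≤_) (sym n≡) (+-monoʳ-≤ (n / S * S) (≮⇒≥ r≮h)) ,
    subst (_< n / S * S + h + t) (sym n≡)
      (subst (n / S * S + n % S <_) (sym (+-assoc (n / S * S) h t)) (+-monoʳ-< (n / S * S) (m%n<n n S))) ,
    λ k lo≤k k<lo+t → colour-high (n / S) k lo≤k (subst (k <_) (+-assoc (n / S * S) h t) k<lo+t)

  blockEnds : ∀ i N → ∃[ m ] (N ≤ m × colour m ≡ i × colour (suc m) ≢ i)
  blockEnds zero N =
    m , ≤-trans (m≤m*n N S) (m≤m+n (N * S) H) ,
    colour-low N m (m≤m+n (N * S) H) (+-monoʳ-< (N * S) (n<1+n H)) ,
    λ eq → Finₚ.0≢1+n (trans (sym eq) colour-1+m)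
    where
    m = N * S + H
    colour-1+m : colour (suc m) ≡ suc (N mod H)
    colour-1+m = colour-high N (suc m) (≤-reflexive (+-suc (N * S) H))
                   (subst (_< N * S + S) (+-suc (N * S) H) (+-monoʳ-< (N * S) (m<m+n h 1≤t)))
  blockEnds (suc j) N =
    m , N≤m , trans colour-m (cong suc (toℕ+kn-mod j N)) , λ eq → Finₚ.0≢1+n (trans (sym colour-1+m) eq)
    where
    q = Fin.toℕ j + N * H
    m = q * S + (H + t)
    N≤m : N ≤ m
    N≤m = ≤-trans (m≤m*n N H) (≤-trans (m≤n+m (N * H) (Fin.toℕ j)) (≤-trans (m≤m*n q S) (m≤m+n (q * S) (H + t))))
    colour-m : colour m ≡ suc (q mod H)
    colour-m = colour-high q m (+-monoʳ-≤ (q * S) (subst (_≤ H + t) (+-comm H 1) (+-monoʳ-≤ H 1≤t)))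
                 (+-monoʳ-< (q * S) (n<1+n (H + t)))
    1+m≡ : suc m ≡ suc q * S
    1+m≡ = trans (sym (+-suc (q * S) (H + t))) (+-comm (q * S) S)
    colour-1+m : colour (suc m) ≡ zero
    colour-1+m = colour-low (suc q) (suc m) (≤-reflexive (sym 1+m≡))
                   (subst (_< suc q * S + h) (sym 1+m≡) (m<m+n (suc q * S) z<s))

  intervals : ∀ i → UnionOfIntervals t (Part colour i)
  intervals i = inBlock , blockEnds i
    where
    inBlock : ∀ n → colour n ≡ i → ∃[ a ] (a ≤ n × n < a + t × (∀ k → a ≤ k → k < a + t → colour k ≡ i))
    inBlock n cn≡i
      with lo , len , t≤len , lo≤n , n<lo+len , mono ← monochromeBlock n
      with a , lo≤a , a≤n , n<a+t , a+t≤lo+len ← window 1≤t t≤len lo≤n n<lo+len =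
      a , a≤n , n<a+t , λ k a≤k k<a+t → trans (mono k (≤-trans lo≤a a≤k) (<-≤-trans k<a+t a+t≤lo+len)) cn≡i

  -- Base-2^S digits

  b M : ℕ
  b = 2 ^ S
  M = 2 ^ h

  instance
    b≢0 : NonZero b
    b≢0 = m^n≢0 2 S
    M≢0 : NonZero M
    M≢0 = m^n≢0 2 h

  1<b : 1 < b
  1<b = ^-monoʳ-< 2 (s<s z<s) (z<s {n = h + t ∸ 1})

  low high : ℕ → ℕ
  low x = x % M
  high x = x / M

  x≡low+high*M : ∀ x → x ≡ low x + high x * M
  x≡low+high*M x = m≡m%n+[m/n]*n x M

  high<2^t : ∀ x → x < b → high x < 2 ^ t
  high<2^t x x<b = m<n*o⇒m/o<n (subst (x <_) b≡2^t*M x<b)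
    where
    b≡2^t*M : b ≡ 2 ^ t * M
    b≡2^t*M = trans (^-distribˡ-+-* 2 h t) (*-comm M (2 ^ t))

  high<h : ∀ x → x < b → high x < h
  high<h x x<b = <-≤-trans (high<2^t x x<b) 2^t≤h

  val : List ℕ → ℕ
  val [] = 0
  val (x ∷ xs) = x + b * val xs

  digitsUpTo : ℕ → ℕ → List ℕ
  digitsUpTo zero n = []
  digitsUpTo (suc k) n = n % b ∷ digitsUpTo k (n / b)

  /b≤pred : ∀ {k} n → n ≤ suc k → n / b ≤ k
  /b≤pred zero _ = subst (_≤ _) (sym (0/n≡0 b)) z≤n
  /b≤pred (suc n) n≤1+k = s≤s⁻¹ (<-≤-trans (m/n<m (suc n) b 1<b) n≤1+k)

  val-digitsUpTo : ∀ k n → n ≤ k → val (digitsUpTo k n) ≡ n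
  val-digitsUpTo zero zero _ = refl
  val-digitsUpTo (suc k) n n≤1+k = begin
    n % b + b * val (digitsUpTo k (n / b))   ≡⟨ cong (λ v → n % b + b * v) (val-digitsUpTo k (n / b) n/b≤k) ⟩
    n % b + b * (n / b)                      ≡⟨ cong (n % b +_) (*-comm b (n / b)) ⟩
    n % b + n / b * b                        ≡⟨ m≡m%n+[m/n]*n n b ⟨
    n                                        ∎
    where
    open ≡-Reasoning
    n/b≤k : n / b ≤ k
    n/b≤k = /b≤pred n n≤1+k

  digitsUpTo-< : ∀ k n → All (_< b) (digitsUpTo k n)
  digitsUpTo-< zero n = []
  digitsUpTo-< (suc k) n = m%n<n n b ∷ digitsUpTo-< k (n / b)

  digits : ℕ → List ℕ
  digits n = digitsUpTo n n

  val≡0 : ∀ ys → val ys ≡ 0 → All (_≡ 0) ys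
  val≡0 [] _ = []
  val≡0 (y ∷ ys) val≡0′ with m*n≡0⇒m≡0∨n≡0 b (m+n≡0⇒n≡0 y val≡0′)
  ... | inj₁ b≡0 = ⊥-elim (<⇒≢ (<-trans z<s 1<b) (sym b≡0))
  ... | inj₂ val-ys≡0 = m+n≡0⇒m≡0 y val≡0′ ∷ val≡0 ys val-ys≡0

  val≡1 : ∀ y ys → val (y ∷ ys) ≡ 1 → y ≡ 1 × val ys ≡ 0
  val≡1 y ys val≡1′ with val ys in eq
  ... | zero = trans (sym (+-identityʳ y)) (trans (cong (y +_) (sym (*-zeroʳ b))) val≡1′) , refl
  ... | suc v = ⊥-elim (<⇒≱ 1<b (≤-trans (m≤m*n b (suc v))
                                    (≤-trans (m≤n+m (b * suc v) y) (≤-reflexive val≡1′))))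

  val≢0⇒Any : ∀ ys → val ys ≢ 0 → Any (_≢ 0) ys
  val≢0⇒Any ys val≢0 with Any.any? (λ y → ¬? (y ≟ 0)) ys
  ... | yes any = any
  ... | no none =
    ⊥-elim (val≢0 (valAll0 ys (All.map (λ {y} → decidable-stable (y ≟ 0)) (All.¬Any⇒All¬ ys none))))
    where
    valAll0 : ∀ ys → All (_≡ 0) ys → val ys ≡ 0
    valAll0 [] [] = refl
    valAll0 (y ∷ ys) (refl ∷ ys≡0) = trans (cong (b *_) (valAll0 ys ys≡0)) (*-zeroʳ b)

  place : (ℕ → ℕ → Vec ℕ h) → List ℕ → ℕ → Vec ℕ h
  place φ [] q = Vec.replicate h 0
  place φ (x ∷ xs) q = Vec.zipWith _+_ (φ q x) (Vec.map (b *_) (place φ xs (suc q)))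

  lookup-place : ∀ φ x xs q j →
    Vec.lookup (place φ (x ∷ xs) q) j ≡ Vec.lookup (φ q x) j + b * Vec.lookup (place φ xs (suc q)) j
  lookup-place φ x xs q j =
    trans (lookup-zipWith _+_ j (φ q x) _)
      (cong (Vec.lookup (φ q x) j +_) (lookup-map j (b *_) (place φ xs (suc q))))

  sum-place : ∀ φ → (∀ q x → x < b → Vec.sum (φ q x) ≡ x) →
              ∀ xs q → All (_< b) xs → Vec.sum (place φ xs q) ≡ val xs
  sum-place φ sum-φ [] q [] = sum-replicate0 h
  sum-place φ sum-φ (x ∷ xs) q (x<b ∷ xs<b) =
    trans (sum-zipWith-+ (φ q x) _)
      (cong₂ _+_ (sum-φ q x x<b)
        (trans (sum-map-* b (place φ xs (suc q))) (cong (b *_) (sum-place φ sum-φ xs (suc q) xs<b))))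

  place-positive : ∀ φ xs q j → Any (λ x → ∀ q → VAll.All (1 ≤_) (φ q x)) xs →
                   1 ≤ Vec.lookup (place φ xs q) j
  place-positive φ (x ∷ xs) q j (Any.here φx≥1) =
    subst (1 ≤_) (sym (lookup-place φ x xs q j)) (≤-trans (VAllₚ.lookup⁺ (φx≥1 q) j) (m≤m+n _ _))
  place-positive φ (x ∷ xs) q j (Any.there any) =
    subst (1 ≤_) (sym (lookup-place φ x xs q j))
      (≤-trans (≤-trans (place-positive φ xs (suc q) j any) (m≤n*m _ b)) (m≤n+m _ _))

  bitSum-place : ∀ (W : Fin h → Pred ℕ 0ℓ) φ (P : Pred ℕ 0ℓ) →
    (∀ q x → P x → ∀ j → BitSum (W j) (q * S) (q * S + S) (Vec.lookup (φ q x) j * 2 ^ (q * S))) →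
    ∀ xs q → All P xs → ∀ j →
    BitSum (W j) (q * S) (q * S + List.length xs * S) (Vec.lookup (place φ xs q) j * 2 ^ (q * S))
  bitSum-place W φ P bitSum-φ [] q [] j =
    subst (λ v → BitSum (W j) _ _ (v * 2 ^ (q * S))) (sym (lookup-replicate j 0)) bitSum-0
  bitSum-place W φ P bitSum-φ (x ∷ xs) q (px ∷ pxs) j =
    subst (BitSum (W j) _ _) (sym split)
      (bitSum-+ (m≤m+n (q * S) S) (+-monoʳ-≤ (q * S) (m≤m+n S (List.length xs * S)))
        (bitSum-φ q x px j)
        (bitSum-widen (≤-reflexive (+-comm (q * S) S))
          (≤-reflexive (trans (cong (_+ List.length xs * S) (+-comm S (q * S))) (+-assoc (q * S) S _)))
          (bitSum-place W φ P bitSum-φ xs (suc q) pxs j)))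
    where
    u = Vec.lookup (φ q x) j
    v = Vec.lookup (place φ xs (suc q)) j
    split : Vec.lookup (place φ (x ∷ xs) q) j * 2 ^ (q * S) ≡ u * 2 ^ (q * S) + v * 2 ^ (suc q * S)
    split = begin
      Vec.lookup (place φ (x ∷ xs) q) j * 2 ^ (q * S)   ≡⟨ cong (_* 2 ^ (q * S)) (lookup-place φ x xs q j) ⟩
      (u + b * v) * 2 ^ (q * S)                          ≡⟨ *-distribʳ-+ (2 ^ (q * S)) u (b * v) ⟩
      u * 2 ^ (q * S) + b * v * 2 ^ (q * S)              ≡⟨ cong (u * 2 ^ (q * S) +_) b*v*2^qS≡ ⟩
      u * 2 ^ (q * S) + v * 2 ^ (suc q * S)              ∎
      where
      open ≡-Reasoning
      b*v*2^qS≡ : b * v * 2 ^ (q * S) ≡ v * 2 ^ (suc q * S)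
      b*v*2^qS≡ = begin
        b * v * 2 ^ (q * S)      ≡⟨ cong (_* 2 ^ (q * S)) (*-comm b v) ⟩
        v * b * 2 ^ (q * S)      ≡⟨ *-assoc v b (2 ^ (q * S)) ⟩
        v * (b * 2 ^ (q * S))    ≡⟨ cong (v *_) (^-distribˡ-+-* 2 S (q * S)) ⟨
        v * 2 ^ (suc q * S)      ∎

  bitSum-lowBlock : ∀ q w → w < M → BitSum (Part colour zero) (q * S) (q * S + S) (w * 2 ^ (q * S))
  bitSum-lowBlock q w w<M =
    bitSum-widen ≤-refl (+-monoʳ-≤ (q * S) (m≤m+n h t)) (bitSum-binary h (q * S) w w<M (colour-low q))

  digitSplit : ℕ → ℕ → Vec ℕ h
  digitSplit q x = low x ∷ (Vec.replicate H 0 [ q mod H ]≔ high x * M)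

  sum-digitSplit : ∀ q x → x < b → Vec.sum (digitSplit q x) ≡ x
  sum-digitSplit q x _ = begin
    low x + Vec.sum (Vec.replicate H 0 [ q mod H ]≔ high x * M)
      ≡⟨ cong (low x +_) (sum-replicate0[]≔ (q mod H) (high x * M)) ⟩
    low x + high x * M
      ≡⟨ x≡low+high*M x ⟨
    x ∎
    where open ≡-Reasoning

  bitSum-digitSplit : ∀ q x → x < b → ∀ j →
    BitSum (Part colour j) (q * S) (q * S + S) (Vec.lookup (digitSplit q x) j * 2 ^ (q * S))
  bitSum-digitSplit q x _ zero = bitSum-lowBlock q (low x) (m%n<n x M)
  bitSum-digitSplit q x x<b (suc i) with i Fin.≟ q mod H
  ... | yes refl = subst (BitSum (Part colour (suc i)) _ _) value≡
        (bitSum-widen (m≤m+n (q * S) h) (≤-reflexive (+-assoc (q * S) h t))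
          (bitSum-binary t (q * S + h) (high x) (high<2^t x x<b)
            λ f qS+h≤f f<qS+h+t → colour-high q f qS+h≤f (subst (f <_) (+-assoc (q * S) h t) f<qS+h+t)))
    where
    value≡ : high x * 2 ^ (q * S + h) ≡ Vec.lookup (digitSplit q x) (suc i) * 2 ^ (q * S)
    value≡ = begin
      high x * 2 ^ (q * S + h)         ≡⟨ cong (λ e → high x * 2 ^ e) (+-comm (q * S) h) ⟩
      high x * 2 ^ (h + q * S)         ≡⟨ cong (high x *_) (^-distribˡ-+-* 2 h (q * S)) ⟩
      high x * (M * 2 ^ (q * S))       ≡⟨ *-assoc (high x) M (2 ^ (q * S)) ⟨
      high x * M * 2 ^ (q * S)         ≡⟨ cong (_* 2 ^ (q * S)) (lookup∘update i (Vec.replicate H 0) (high x * M)) ⟨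
      Vec.lookup (digitSplit q x) (suc i) * 2 ^ (q * S)   ∎
      where open ≡-Reasoning
  ... | no i≢k = subst (λ v → BitSum (Part colour (suc i)) _ _ (v * 2 ^ (q * S))) value≡0 bitSum-0
    where
    value≡0 : 0 ≡ Vec.lookup (digitSplit q x) (suc i)
    value≡0 = sym (trans (lookup∘update′ i≢k (Vec.replicate H 0) (high x * M)) (lookup-replicate i 0))

  natural : ℕ → Vec ℕ h
  natural n = place digitSplit (digits n) 0

  sum-natural : ∀ n → Vec.sum (natural n) ≡ n
  sum-natural n =
    trans (sum-place digitSplit sum-digitSplit (digits n) 0 (digitsUpTo-< n n)) (val-digitsUpTo n n ≤-refl)

  bitSum-natural : ∀ n j → BitSum (Part colour j) 0 (List.length (digits n) * S) (Vec.lookup (natural n) j)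
  bitSum-natural n j = subst (BitSum (Part colour j) _ _) (*-identityʳ _)
    (bitSum-place (Part colour) digitSplit (_< b) bitSum-digitSplit (digits n) 0 (digitsUpTo-< n n) j)

  low-digits : ∀ xs q → Vec.lookup (place digitSplit xs q) zero ≡ val (List.map low xs)
  low-digits [] q = refl
  low-digits (x ∷ xs) q =
    trans (lookup-place digitSplit x xs q zero) (cong (λ v → low x + b * v) (low-digits xs (suc q)))

  -- A ∖ {1} is a basis of order h

  B : Pred ℕ 0ℓ
  B y = UnionA colour y × y ≢ 1

  Rep : Pred ℕ 0ℓ
  Rep = Representable h B

  B-2^ : ∀ f → 1 ≤ f → B (2 ^ f)
  B-2^ (suc f) _ = (colour (suc f) , suc f ∷ [] , (λ ()) , [] ∷ [] , refl ∷ [] , sym (+-identityʳ _)) ,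
                   even≢odd (2 ^ f) 0

  B-2^+1 : ∀ g → 1 ≤ g → colour g ≡ zero → B (2 ^ g + 1)
  B-2^+1 g 1≤g cg≡0 =
    (zero , A-∑2^ {F = g ∷ 0 ∷ []} (((λ g≡0 → <⇒≢ 1≤g (sym g≡0)) ∷ []) ∷ [] ∷ [])
                                    (cg≡0 ∷ colour-low 0 0 z≤n z<s ∷ []) (m+1+n≢0 (2 ^ g))) ,
    λ 2^g+1≡1 → <⇒≢ (m^n>0 2 g) (sym (+-cancelʳ-≡ 1 (2 ^ g) 0 2^g+1≡1))

  ∑2^-coloured≢1 : ∀ {i F} → All (Part colour (suc i)) F → ∑2^ F ≢ 1
  ∑2^-coloured≢1 = ∑2^≢1 ∘ All.map (λ {f} cf≡ → ≤-trans (s≤s z≤n) (colour≡suc⇒h≤ f cf≡))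

  bitSum-coloured≢1 : ∀ {i lo hi v} → BitSum (Part colour (suc i)) lo hi v → v ≢ 1
  bitSum-coloured≢1 (F , _ , cF , _ , refl) = ∑2^-coloured≢1 cF

  nonzeroIn-natural : ∀ n → Vec.lookup (natural n) zero ≢ 1 → NonzeroIn {B} (natural n)
  nonzeroIn-natural n v₀≢1 = VAllₚ.lookup⁻ λ where
    zero v₀≢0 → (zero , bitSum⇒A (bitSum-natural n zero) v₀≢0) , v₀≢1
    (suc i) vᵢ≢0 → (suc i , bitSum⇒A (bitSum-natural n (suc i)) vᵢ≢0) ,
                   bitSum-coloured≢1 (bitSum-natural n (suc i))

  representable-spread : ∀ {n} (v : Vec ℕ h) f → NonzeroIn v → 1 ≤ zeros v → zeros v ≤ f →
                         Vec.sum v + 2 ^ f ≡ n → Rep n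
  representable-spread v f good 1≤z z≤f sum≡ with Bs , sum-spread ← spread-sound B-2^ v f good 1≤z z≤f =
    spread v f , Bs , trans (sym sum≡) (sym sum-spread)

  representable-release : ∀ {n} (v : Vec ℕ h) j f y → NonzeroIn v → Vec.sum v ≡ n →
    Vec.lookup v j ≡ 2 ^ f + y → (y ≢ 0 → B y) → 1 ≤ zeros v → h ≤ f → Rep n
  representable-release {n} v j f y good sum≡ vⱼ≡ y-good 1≤z h≤f =
    representable-spread (v [ j ]≔ y) f (All-[]≔ j good y-good)
      (≤-trans 1≤z (zeros-[]≔ v j y vⱼ≢0)) (≤-trans (count≤n (_≟ 0) (v [ j ]≔ y)) h≤f)
      (+-cancelʳ-≡ y _ _ (begin
        Vec.sum (v [ j ]≔ y) + 2 ^ f + y     ≡⟨ +-assoc (Vec.sum (v [ j ]≔ y)) (2 ^ f) y ⟩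
        Vec.sum (v [ j ]≔ y) + (2 ^ f + y)   ≡⟨ cong (Vec.sum (v [ j ]≔ y) +_) vⱼ≡ ⟨
        Vec.sum (v [ j ]≔ y) + Vec.lookup v j ≡⟨ sum-[]≔ v j y ⟩
        Vec.sum v + y                         ≡⟨ cong (_+ y) sum≡ ⟩
        n + y                                 ∎))
    where
    open ≡-Reasoning
    vⱼ≢0 : Vec.lookup v j ≢ 0
    vⱼ≢0 vⱼ≡0 = <⇒≢ (≤-trans (m^n>0 2 f) (m≤m+n (2 ^ f) y)) (sym (trans (sym vⱼ≡) vⱼ≡0))

  colour-boundary : ∀ g → colour (suc g) ≡ zero → colour g ≢ zero → suc g ≡ suc (g / S) * S
  colour-boundary g c1+g≡0 cg≢0 with suc (g % S) <? S
  ... | yes 1+r<S = ⊥-elim (Finₚ.0≢1+n (trans (sym c1+g≡0) (colour-high (g / S) (suc g) lo≤1+g 1+g<hi)))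
    where
    lo≤1+g : g / S * S + h ≤ suc g
    lo≤1+g = ≤-trans (+-monoʳ-≤ (g / S * S) (colour≢zero⇒ g cg≢0))
               (≤-trans (≤-reflexive (sym (n≡[n/S]S+n%S g))) (n≤1+n g))
    1+g<hi : suc g < g / S * S + S
    1+g<hi = subst (_< g / S * S + S) (trans (+-suc (g / S * S) (g % S)) (cong suc (sym (n≡[n/S]S+n%S g))))
               (+-monoʳ-< (g / S * S) 1+r<S)
  ... | no 1+r≮S = begin
    suc g                      ≡⟨ cong suc (n≡[n/S]S+n%S g) ⟩
    suc (g / S * S + g % S)    ≡⟨ +-suc (g / S * S) (g % S) ⟨
    g / S * S + suc (g % S)    ≡⟨ cong (g / S * S +_) (≤-antisym (m%n<n g S) (≮⇒≥ 1+r≮S)) ⟩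
    g / S * S + S              ≡⟨ +-comm (g / S * S) S ⟩
    suc (g / S) * S            ∎
    where open ≡-Reasoning

  representable-2^[1+g]+1 : ∀ g → H ≤ g → colour g ≡ zero → Rep (2 ^ suc g + 1)
  representable-2^[1+g]+1 g H≤g cg≡0 =
    representable-spread v g ((λ _ → B-2^+1 g 1≤g cg≡0) ∷ nonzeroIn-replicate H)
      (subst (1 ≤_) (sym zeros-v) z<s) (≤-trans (≤-reflexive zeros-v) H≤g) sum≡
    where
    1≤g : 1 ≤ g
    1≤g = ≤-trans z<s H≤g
    v : Vec ℕ h
    v = 2 ^ g + 1 ∷ Vec.replicate H 0
    zeros-v : zeros v ≡ H
    zeros-v = trans (zeros-nonzero∷ (Vec.replicate H 0) (m+1+n≢0 (2 ^ g))) (zeros-replicate H)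
    sum≡ : Vec.sum v + 2 ^ g ≡ 2 ^ suc g + 1
    sum≡ = trans (cong (λ z → 2 ^ g + 1 + z + 2 ^ g) (sum-replicate0 H))
                 (rearrange (2 ^ g))
      where
      rearrange : ∀ p → p + 1 + 0 + p ≡ p + (p + 0) + 1
      rearrange = solve-∀

  B-highBlock : ∀ q → B ((2 ^ t ∸ 1) * 2 ^ suc (q * S + H))
  B-highBlock q = (suc (q mod H) , bitSum⇒A bitSum-X X≢0) , bitSum-coloured≢1 bitSum-X
    where
    bitSum-X : BitSum (Part colour (suc (q mod H))) (q * S + h) (q * S + h + t) ((2 ^ t ∸ 1) * 2 ^ suc (q * S + H))
    bitSum-X = subst (λ e → BitSum (Part colour (suc (q mod H))) (q * S + h) (q * S + h + t) ((2 ^ t ∸ 1) * 2 ^ e))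
                 (+-suc (q * S) H)
      (bitSum-binary t (q * S + h) (2 ^ t ∸ 1) (∸-monoʳ-< {o = 0} z<s (m^n>0 2 t))
        λ f qS+h≤f f<qS+h+t → colour-high q f qS+h≤f (subst (f <_) (+-assoc (q * S) h t) f<qS+h+t))
    X≢0 : (2 ^ t ∸ 1) * 2 ^ suc (q * S + H) ≢ 0
    X≢0 X≡0 with m*n≡0⇒m≡0∨n≡0 (2 ^ t ∸ 1) X≡0
    ... | inj₁ 2^t∸1≡0 = <⇒≢ (m<n⇒0<n∸m (^-monoʳ-≤ 2 1≤t)) (sym 2^t∸1≡0)
    ... | inj₂ 2^e≡0 = <⇒≢ (m^n>0 2 (suc (q * S + H))) (sym 2^e≡0)

  representable-2^[1+q]S+1 : ∀ q → Rep (2 ^ (suc q * S) + 1)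
  representable-2^[1+q]S+1 q =
    representable-spread v o ((λ _ → B-2^+1 o 1≤o co≡0) ∷ (λ _ → B-highBlock q) ∷ nonzeroIn-replicate H₁)
      (subst (1 ≤_) (sym zeros-v) 1≤H₁) (≤-trans (≤-reflexive zeros-v) H₁≤o) sum≡
    where
    o = q * S + H
    H₁≤o : H₁ ≤ o
    H₁≤o = ≤-trans (n≤1+n H₁) (m≤n+m H (q * S))
    1≤o : 1 ≤ o
    1≤o = ≤-trans 1≤H₁ H₁≤o
    co≡0 : colour o ≡ zero
    co≡0 = colour-low q o (m≤m+n (q * S) H) (+-monoʳ-< (q * S) (n<1+n H))
    X = (2 ^ t ∸ 1) * 2 ^ suc o
    v : Vec ℕ h
    v = 2 ^ o + 1 ∷ X ∷ Vec.replicate H₁ 0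
    zeros-v : zeros v ≡ H₁
    zeros-v = trans (zeros-nonzero∷ (X ∷ Vec.replicate H₁ 0) (m+1+n≢0 (2 ^ o)))
                (trans (zeros-nonzero∷ (Vec.replicate H₁ 0) (A⇒≢0 (proj₂ (proj₁ (B-highBlock q)))))
                  (zeros-replicate H₁))
    sum≡ : Vec.sum v + 2 ^ o ≡ 2 ^ (suc q * S) + 1
    sum≡ = begin
      2 ^ o + 1 + (X + Vec.sum (Vec.replicate H₁ 0)) + 2 ^ o
        ≡⟨ cong (λ z → 2 ^ o + 1 + z + 2 ^ o) (trans (cong (X +_) (sum-replicate0 H₁)) (+-identityʳ X)) ⟩
      2 ^ o + 1 + X + 2 ^ o       ≡⟨ 2^e+1+[2^t-1]2^[1+e]+2^e≡2^[t+1+e]+1 t o (m^n>0 2 t) ⟩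
      2 ^ (t + suc o) + 1         ≡⟨ cong (λ e → 2 ^ e + 1) (shuffle t (q * S) H) ⟩
      2 ^ (suc q * S) + 1         ∎
      where
      open ≡-Reasoning
      shuffle : ∀ t x y → t + suc (x + y) ≡ suc y + t + x
      shuffle = solve-∀

  -- Taking 2^f out of 2^f + 1 would leave the summand 1, so 2^f is split below f instead: inside
  -- the colour-0 block when f − 1 has colour 0, and otherwise (f starts a period) using the full
  -- coloured block just below f.
  representable-2^+1 : ∀ f → h ≤ f → colour f ≡ zero → Rep (2 ^ f + 1)
  representable-2^+1 (suc g) (s≤s H≤g) c1+g≡0 with colour g Fin.≟ zero
  ... | yes cg≡0 = representable-2^[1+g]+1 g H≤g cg≡0
  ... | no cg≢0 = subst (λ e → Rep (2 ^ e + 1)) (sym (colour-boundary g c1+g≡0 cg≢0))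
                    (representable-2^[1+q]S+1 (g / S))

  module _ (n : ℕ) (v₀≢1 : Vec.lookup (natural n) zero ≢ 1) (1≤zeros : 1 ≤ zeros (natural n)) where

    release-coloured : ∀ i → Vec.lookup (natural n) (suc i) ≢ 0 → Rep n
    release-coloured i vᵢ≢0 with bitSum-natural n (suc i)
    ... | [] , _ , _ , _ , vᵢ≡0 = ⊥-elim (vᵢ≢0 vᵢ≡0)
    ... | f ∷ F , _ ∷ uF , cf ∷ cF , _ , vᵢ≡ =
      representable-release (natural n) (suc i) f (∑2^ F) (nonzeroIn-natural n v₀≢1) (sum-natural n) vᵢ≡
        (λ ∑F≢0 → (suc i , A-∑2^ uF cF ∑F≢0) , ∑2^-coloured≢1 cF) 1≤zeros (colour≡suc⇒h≤ f cf)

    release-low : b ≤ n → (∀ i → Vec.lookup (natural n) (suc i) ≡ 0) → Rep n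
    release-low b≤n coloured≡0 = releaseTop (bitSum-natural n zero)
      where
      n≡v₀ : n ≡ Vec.lookup (natural n) zero
      n≡v₀ = trans (sym (sum-natural n)) (sum-zeroTail (natural n) coloured≡0)
      releaseTop : ∀ {lo hi} → BitSum (Part colour zero) lo hi (Vec.lookup (natural n) zero) → Rep n
      releaseTop (F , uF , cF , _ , v₀≡)
        with f , f∈F , h≤f ← find (2^K≤∑2^⇒∃exponent≥K h F uF
                                   (≤-trans (^-monoʳ-≤ 2 (m≤m+n h t)) (≤-trans b≤n (≤-reflexive (trans n≡v₀ v₀≡)))))
        with R , uR , cR , _ , ∑F≡ ← ∑2^-remove uF cF f∈F
        with ∑2^ R ≟ 1
      ... | yes ∑R≡1 = subst Rep (trans (cong (2 ^ f +_) (sym ∑R≡1)) (sym (trans n≡v₀ (trans v₀≡ ∑F≡))))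
                         (representable-2^+1 f h≤f (All.lookup cF f∈F))
      ... | no ∑R≢1 =
        representable-release (natural n) zero f (∑2^ R) (nonzeroIn-natural n v₀≢1) (sum-natural n)
          (trans v₀≡ ∑F≡) (λ ∑R≢0 → (zero , A-∑2^ uR cR ∑R≢0) , ∑R≢1) 1≤zeros h≤f

  representable-natural : ∀ n → b ≤ n → Vec.lookup (natural n) zero ≢ 1 → Rep n
  representable-natural n b≤n v₀≢1 with zeros (natural n) ≟ 0
  ... | yes zeros≡0 =
    natural n , nonzeroIn⇒All (natural n) (nonzeroIn-natural n v₀≢1) zeros≡0 , sym (sum-natural n)
  ... | no zeros≢0 with Finₚ.any? (λ i → ¬? (Vec.lookup (natural n) (suc i) ≟ 0))
  ... | yes (i , vᵢ≢0) = release-coloured n v₀≢1 (n≢0⇒n>0 zeros≢0) i vᵢ≢0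
  ... | no ∄i = release-low n v₀≢1 (n≢0⇒n>0 zeros≢0) b≤n
                  λ i → decidable-stable (Vec.lookup (natural n) (suc i) ≟ 0) (λ vᵢ≢0 → ∄i (i , vᵢ≢0))

  top : ℕ
  top = M ∸ 1

  top+1≡M : top + 1 ≡ M
  top+1≡M = m∸n+n≡m (m^n>0 2 h)

  top<M : top < M
  top<M = subst (top <_) top+1≡M (m<m+n top z<s)

  h≤top : h ≤ top
  h≤top = +-cancelʳ-≤ 1 h top (subst (h + 1 ≤_) (sym top+1≡M) (subst (_≤ M) (+-comm 1 h) (n<2^n h)))

  topsThen : ∀ k → ℕ → ℕ → ℕ → Vec ℕ k
  topsThen zero d x y = []
  topsThen (suc k) zero x y = x ∷ Vec.replicate k y
  topsThen (suc k) (suc d) x y = top ∷ topsThen k d x y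

  sum-topsThen : ∀ k d x y → d < k → Vec.sum (topsThen k d x y) ≡ d * top + x + (k ∸ suc d) * y
  sum-topsThen (suc k) zero x y _ = cong (x +_) (sum-replicate k y)
  sum-topsThen (suc k) (suc d) x y (s<s d<k) =
    trans (cong (top +_) (sum-topsThen k d x y d<k))
      (trans (sym (+-assoc top _ _)) (cong (_+ (k ∸ suc d) * y) (sym (+-assoc top (d * top) x))))

  All-topsThen : ∀ {P : Pred ℕ 0ℓ} k d x y → P top → P x → P y → VAll.All P (topsThen k d x y)
  All-topsThen zero d x y _ _ _ = []
  All-topsThen (suc k) zero x y _ px py = px ∷ All-replicate k py
  All-topsThen (suc k) (suc d) x y ptop px py = ptop ∷ All-topsThen k d x y ptop px py

  d*top+d≡d*M : ∀ d → d * top + d ≡ d * M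
  d*top+d≡d*M d = trans (cong (d * top +_) (sym (*-identityʳ d)))
                    (trans (sym (*-distribˡ-+ d top 1)) (cong (d *_) top+1≡M))

  plainSplit : ℕ → ℕ → Vec ℕ h
  plainSplit d e = topsThen h d (d + e) 0

  sum-plainSplit : ∀ d e → d < h → Vec.sum (plainSplit d e) ≡ e + d * M
  sum-plainSplit d e d<h = begin
    Vec.sum (plainSplit d e)              ≡⟨ sum-topsThen h d (d + e) 0 d<h ⟩
    d * top + (d + e) + (h ∸ suc d) * 0   ≡⟨ cong (d * top + (d + e) +_) (*-zeroʳ (h ∸ suc d)) ⟩
    d * top + (d + e) + 0                 ≡⟨ +-identityʳ _ ⟩
    d * top + (d + e)                     ≡⟨ +-assoc (d * top) d e ⟨
    d * top + d + e                       ≡⟨ cong (_+ e) (d*top+d≡d*M d) ⟩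
    d * M + e                             ≡⟨ +-comm (d * M) e ⟩
    e + d * M                             ∎
    where open ≡-Reasoning

  -- plainSplit d 0 with its H ∸ d trailing zeros turned into ones, paid for by the first entry.
  positiveSplit : ℕ → Vec ℕ h
  positiveSplit zero = plainSplit 0 0
  positiveSplit (suc d) = top ∸ (H ∸ suc d) ∷ topsThen H d (suc d) 1

  sum-positiveSplit : ∀ d → d < h → Vec.sum (positiveSplit d) ≡ d * M
  sum-positiveSplit zero _ = sum-plainSplit 0 0 z<s
  sum-positiveSplit (suc d) (s<s d<H) = begin
    top ∸ r + Vec.sum (topsThen H d (suc d) 1)   ≡⟨ cong (top ∸ r +_) (sum-topsThen H d (suc d) 1 d<H) ⟩
    top ∸ r + (d * top + suc d + r * 1)          ≡⟨ cong (λ z → top ∸ r + (d * top + suc d + z)) (*-identityʳ r) ⟩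
    top ∸ r + (d * top + suc d + r)              ≡⟨ rearrange (top ∸ r) (d * top) (suc d) r ⟩
    top ∸ r + r + d * top + suc d                ≡⟨ cong (λ z → z + d * top + suc d) (m∸n+n≡m r≤top) ⟩
    top + d * top + suc d                        ≡⟨ d*top+d≡d*M (suc d) ⟩
    suc d * M                                    ∎
    where
    open ≡-Reasoning
    r = H ∸ suc d
    r≤top : r ≤ top
    r≤top = ≤-trans (m∸n≤m H (suc d)) (≤-trans (n≤1+n H) h≤top)
    rearrange : ∀ a b c d → a + (b + c + d) ≡ a + d + b + c
    rearrange = solve-∀

  1<M : 1 < M
  1<M = ^-monoʳ-≤ 2 {1} {h} z<s

  plainSplit-<M : ∀ d e → d + e < M → VAll.All (_< M) (plainSplit d e)
  plainSplit-<M d e d+e<M = All-topsThen h d (d + e) 0 top<M d+e<M (<-trans z<s 1<M)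

  positiveSplit-<M : ∀ d → d < h → VAll.All (_< M) (positiveSplit d)
  positiveSplit-<M zero _ = plainSplit-<M 0 0 (<-trans z<s 1<M)
  positiveSplit-<M (suc d) 1+d<h =
    ≤-<-trans (m∸n≤m top (H ∸ suc d)) top<M ∷
    All-topsThen H d (suc d) 1 top<M (<-trans 1+d<h (n<2^n h)) 1<M

  positiveSplit-positive : ∀ d → 1 ≤ d → VAll.All (1 ≤_) (positiveSplit d)
  positiveSplit-positive (suc d) _ =
    m<n⇒0<n∸m (≤-<-trans (m∸n≤m H (suc d)) h≤top) ∷ All-topsThen H d (suc d) 1 (≤-trans z<s h≤top) z<s ≤-refl

  high+low<M : ∀ x → x < b → low x ≤ 1 → high x + low x < M
  high+low<M x x<b low≤1 = begin-strict
    high x + low x   ≤⟨ +-monoʳ-≤ (high x) low≤1 ⟩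
    high x + 1       ≡⟨ +-comm (high x) 1 ⟩
    suc (high x)     ≤⟨ high<h x x<b ⟩
    h                <⟨ n<2^n h ⟩
    M                ∎
    where open ≤-Reasoning

  1≤high : ∀ x → x ≢ 0 → low x ≡ 0 → 1 ≤ high x
  1≤high x x≢0 low≡0 with high x in high≡
  ... | zero = ⊥-elim (x≢0 (trans (x≡low+high*M x) (cong₂ (λ l d → l + d * M) low≡0 high≡)))
  ... | suc _ = s≤s z≤n

  lowSplit : ℕ → ℕ → Vec ℕ h
  lowSplit _ x with low x ≟ 0 | 1 ≤? high x
  ... | yes _ | yes _ = positiveSplit (high x)
  ... | _ | _ = plainSplit (high x) (low x)

  sum-lowSplit : ∀ q x → x < b → Vec.sum (lowSplit q x) ≡ x
  sum-lowSplit _ x x<b with low x ≟ 0 | 1 ≤? high x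
  ... | yes low≡0 | yes _ = trans (sum-positiveSplit (high x) (high<h x x<b))
                              (sym (trans (x≡low+high*M x) (cong (_+ high x * M) low≡0)))
  ... | yes _ | no _ = trans (sum-plainSplit (high x) (low x) (high<h x x<b)) (sym (x≡low+high*M x))
  ... | no _ | _ = trans (sum-plainSplit (high x) (low x) (high<h x x<b)) (sym (x≡low+high*M x))

  lowSplit-<M : ∀ q x → x < b → low x ≤ 1 → VAll.All (_< M) (lowSplit q x)
  lowSplit-<M _ x x<b low≤1 with low x ≟ 0 | 1 ≤? high x
  ... | yes _ | yes _ = positiveSplit-<M (high x) (high<h x x<b)
  ... | yes _ | no _ = plainSplit-<M (high x) (low x) (high+low<M x x<b low≤1)
  ... | no _ | _ = plainSplit-<M (high x) (low x) (high+low<M x x<b low≤1)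

  lowSplit-positive : ∀ q x → low x ≡ 0 → 1 ≤ high x → VAll.All (1 ≤_) (lowSplit q x)
  lowSplit-positive _ x low≡0 1≤high with low x ≟ 0 | 1 ≤? high x
  ... | yes _ | yes _ = positiveSplit-positive (high x) 1≤high
  ... | no low≢0 | _ = ⊥-elim (low≢0 low≡0)
  ... | yes _ | no 1≰high = ⊥-elim (1≰high 1≤high)

  representable-lowDigits : ∀ {n} x₀ xs → All (_< b) (x₀ ∷ xs) → val (x₀ ∷ xs) ≡ n →
    low x₀ ≤ 1 → All (λ x → low x ≡ 0) xs → Any (_≢ 0) xs → Rep n
  representable-lowDigits x₀ xs digits<b val≡n low-x₀≤1 low-xs≡0 xs≢0 = a , VAllₚ.lookup⁻ B-aⱼ , sym sum-a
    where
    a : Vec ℕ h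
    a = place lowSplit (x₀ ∷ xs) 0
    sum-a : Vec.sum a ≡ _
    sum-a = trans (sum-place lowSplit sum-lowSplit (x₀ ∷ xs) 0 digits<b) val≡n
    positiveDigit : Any (λ x → ∀ q → VAll.All (1 ≤_) (lowSplit q x)) xs
    positiveDigit =
      let x , x∈xs , x≢0 = find xs≢0
          low≡0 = All.lookup low-xs≡0 x∈xs
      in lose x∈xs λ q → lowSplit-positive q x low≡0 (1≤high x x≢0 low≡0)
    b≤aⱼ : ∀ j → b ≤ Vec.lookup a j
    b≤aⱼ j = subst (b ≤_) (sym (lookup-place lowSplit x₀ xs 0 j))
               (≤-trans (≤-reflexive (sym (*-identityʳ b)))
                 (≤-trans (*-monoʳ-≤ b (place-positive lowSplit xs 1 j positiveDigit)) (m≤n+m _ _)))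
    low≤1 : All (λ x → low x ≤ 1) (x₀ ∷ xs)
    low≤1 = low-x₀≤1 ∷ All.map (λ low≡0 → ≤-trans (≤-reflexive low≡0) z≤n) low-xs≡0
    bitSum-aⱼ : ∀ j → BitSum (Part colour zero) 0 (List.length (x₀ ∷ xs) * S) (Vec.lookup a j)
    bitSum-aⱼ j = subst (BitSum (Part colour zero) _ _) (*-identityʳ _)
      (bitSum-place (λ _ → Part colour zero) lowSplit (λ x → x < b × low x ≤ 1)
        (λ q x (x<b , low≤1) j → bitSum-lowBlock q _ (VAllₚ.lookup⁺ (lowSplit-<M q x x<b low≤1) j))
        (x₀ ∷ xs) 0 (All.zip (digits<b , low≤1)) j)
    B-aⱼ : ∀ j → B (Vec.lookup a j)
    B-aⱼ j = (zero , bitSum⇒A (bitSum-aⱼ j) λ aⱼ≡0 → <⇒≢ (<-≤-trans (<-trans z<s 1<b) (b≤aⱼ j)) (sym aⱼ≡0)) ,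
             λ aⱼ≡1 → <⇒≢ (<-≤-trans 1<b (b≤aⱼ j)) (sym aⱼ≡1)

  representable-redistributed : ∀ n → b ≤ n → Vec.lookup (natural n) zero ≡ 1 → Rep n
  representable-redistributed zero b≤0 _ = ⊥-elim (<⇒≱ (<-trans z<s 1<b) b≤0)
  representable-redistributed n@(suc n′) b≤n v₀≡1 =
    representable-lowDigits x₀ xs (digitsUpTo-< n n) (val-digitsUpTo n n ≤-refl) (≤-reflexive (proj₁ lowFacts))
      (All.map⁻ (val≡0 _ (proj₂ lowFacts))) (val≢0⇒Any xs val-xs≢0)
    where
    x₀ = n % b
    xs = digitsUpTo n′ (n / b)
    lowFacts : low x₀ ≡ 1 × val (List.map low xs) ≡ 0
    lowFacts = val≡1 (low x₀) (List.map low xs) (trans (sym (low-digits (digits n) 0)) v₀≡1)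
    val-xs≢0 : val xs ≢ 0
    val-xs≢0 val≡0′ = <⇒≱ (m%n<n n b) (≤-trans b≤n (≤-reflexive (begin
      n                ≡⟨ val-digitsUpTo n n ≤-refl ⟨
      x₀ + b * val xs  ≡⟨ cong (λ v → x₀ + b * v) val≡0′ ⟩
      x₀ + b * 0       ≡⟨ cong (x₀ +_) (*-zeroʳ b) ⟩
      x₀ + 0           ≡⟨ +-identityʳ x₀ ⟩
      x₀               ∎)))
      where open ≡-Reasoning

  representable : ∀ n → b ≤ n → Rep n
  representable n b≤n with Vec.lookup (natural n) zero ≟ 1
  ... | yes v₀≡1 = representable-redistributed n b≤n v₀≡1
  ... | no v₀≢1 = representable-natural n b≤n v₀≢1

  notMinimal : ¬ IsMinimalAsymptoticBasis h (UnionA colour)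
  notMinimal (_ , minimal) = minimal B proj₁ (1 , 1∈A , λ B1 → proj₂ B1 refl) (b , representable)
    where
    1∈A : UnionA colour 1
    1∈A = zero , 0 ∷ [] , (λ ()) , [] ∷ [] , colour-low 0 0 z≤n z<s ∷ [] , refl

theorem1 : (h t : ℕ) → 2 ≤ t → 2 ^ t ≤ h →
    Σ (ℕ → Fin h) λ c →
      ((i : Fin h) → UnionOfIntervals t (Part c i)) ×
      ¬ IsMinimalAsymptoticBasis h (UnionA c)
theorem1 h t 2≤t 2^t≤h with ≤-trans (^-monoʳ-≤ 2 2≤t) 2^t≤h
theorem1 (suc (suc H₁)) t 2≤t 2^t≤h | s≤s (s≤s 2≤H₁) = colour , intervals , notMinimal
  where open Construction H₁ t (≤-trans z<s 2≤H₁) (≤-trans z<s 2≤t) 2^t≤h
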